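{- There exist absolute constants $c>0$ and $l_0$ such that the following holds for all integers $l\ge l_0$. Let integers $l_1,l_2$ satisfy $0.01l<l_1<0.0101l$ and $0.9901l<l_2<0.9999l$, and let $k=\left\lfloor\frac{l^2+l_1^2-l_2^2}{2l_1}\right\rfloor$. Then \[ \left|\langle l_1\,l_1\,l_2\,(k-l_1)\,|\,l\,k\rangle\right|\ge l^{ -c}. \]
   Context: $\langle l_1 m_1 l_2 m_2|l m\rangle$ denotes the (real) Clebsch–Gordan coefficient of $SO(3)$, given by Racah's formula \[ \langle l_1m_1l_2m_2|lm\rangle=1_{m_1+m_2=m}\sqrt{\tfrac{(2l+1)(l+l_1-l_2)!(l-l_1+l_2)!(l_1+l_2-l)!}{(l_1+l_2+l+1)!}}\sqrt{(l+m)!(l-m)!(l_1-m_1)!(l_1+m_1)!(l_2-m_2)!(l_2+m_2)!}\sum_k\tfrac{(-1)^k}{k!(l_1+l_2-l-k)!(l_1-m_1-k)!(l_2+m_2-k)!(l-l_2+m_1+k)!(l-l_1-m_2+k)!}, \] the sum being over integers $k$ for which all factorial arguments are nonnegative (and the coefficient is $0$ if $l_1,l_2,l$ violate the triangle inequality or $|m_i|>l_i$). -}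

module Defs where

open import Data.Nat as ℕ using (ℕ; zero; suc)
open import Data.Nat using (_!)
open import Data.Integer as ℤ using (ℤ; +_; -[1+_]; ∣_∣)
open import Data.Rational as ℚ using (ℚ; 0ℚ; 1ℚ)
open import Data.Bool using (Bool; true; false; if_then_else_; _∧_)
open import Data.List using (List; foldr; map; upTo)

-- 1/n as a rational (value 0 at n = 0; only used at nonzero n)
recipℕ : ℕ → ℚ
recipℕ zero    = 0ℚ
recipℕ (suc n) = (+ 1) ℚ./ suc n

ℕ→ℚ : ℕ → ℚ
ℕ→ℚ n = (+ n) ℚ./ 1

nonneg : ℤ → Bool
nonneg (+ _)     = true
nonneg -[1+ _ ]  = false

_==ℤ_ : ℤ → ℤ → Bool
x ==ℤ y = nonneg (x ℤ.- y) ∧ nonneg (y ℤ.- x)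

fac : ℤ → ℕ
fac x = ∣ x ∣ !

sumℚ : List ℚ → ℚ
sumℚ = foldr ℚ._+_ 0ℚ

racahTerm : ℤ → ℤ → ℤ → ℤ → ℤ → ℤ → ℕ → ℚ
racahTerm l₁ m₁ l₂ m₂ l m k =
  let kk = + k
      a₁ = l₁ ℤ.+ l₂ ℤ.- l ℤ.- kk
      a₂ = l₁ ℤ.- m₁ ℤ.- kk
      a₃ = l₂ ℤ.+ m₂ ℤ.- kk
      a₄ = l ℤ.- l₂ ℤ.+ m₁ ℤ.+ kk
      a₅ = l ℤ.- l₁ ℤ.- m₂ ℤ.+ kk
      sgn = if ℕ._≡ᵇ_ (k ℕ.% 2) 0 then 1ℚ else ℚ.- 1ℚ
  in if nonneg a₁ ∧ nonneg a₂ ∧ nonneg a₃ ∧ nonneg a₄ ∧ nonneg a₅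
     then sgn ℚ.* recipℕ ((k !) ℕ.* fac a₁ ℕ.* fac a₂ ℕ.* fac a₃ ℕ.* fac a₄ ℕ.* fac a₅)
     else 0ℚ

-- Racah's sum over k; every k with nonnegative factorial arguments satisfies
-- 0 ≤ k ≤ l₁ + l₂ - l, so summing over 0 ≤ k ≤ l₁ + l₂ + l is exhaustive.
racahSum : ℕ → ℤ → ℕ → ℤ → ℕ → ℤ → ℚ
racahSum l₁ m₁ l₂ m₂ l m =
  sumℚ (map (racahTerm (+ l₁) m₁ (+ l₂) m₂ (+ l) m) (upTo (suc (l₁ ℕ.+ l₂ ℕ.+ l))))

admissible : ℕ → ℤ → ℕ → ℤ → ℕ → ℤ → Bool
admissible l₁ m₁ l₂ m₂ l m =
  ((m₁ ℤ.+ m₂) ==ℤ m)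
  ∧ nonneg (+ l ℤ.+ + l₁ ℤ.- + l₂) ∧ nonneg (+ l ℤ.- + l₁ ℤ.+ + l₂) ∧ nonneg (+ l₁ ℤ.+ + l₂ ℤ.- + l)
  ∧ nonneg (+ l₁ ℤ.- m₁) ∧ nonneg (+ l₁ ℤ.+ m₁)
  ∧ nonneg (+ l₂ ℤ.- m₂) ∧ nonneg (+ l₂ ℤ.+ m₂)
  ∧ nonneg (+ l ℤ.- m) ∧ nonneg (+ l ℤ.+ m)

-- The SQUARE of the Clebsch–Gordan coefficient ⟨l₁ m₁ l₂ m₂ | l m⟩ given by
-- Racah's formula: the two square roots are squared away, so this is
--   (2l+1)(l+l₁-l₂)!(l-l₁+l₂)!(l₁+l₂-l)!/(l₁+l₂+l+1)!
--   · (l+m)!(l-m)!(l₁-m₁)!(l₁+m₁)!(l₂-m₂)!(l₂+m₂)! · (Racah sum)²,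
-- and 0 in the non-admissible cases.
CGsq : ℕ → ℤ → ℕ → ℤ → ℕ → ℤ → ℚ
CGsq l₁ m₁ l₂ m₂ l m =
  if admissible l₁ m₁ l₂ m₂ l m
  then ℕ→ℚ (((2 ℕ.* l ℕ.+ 1) ℕ.* fac (+ l ℤ.+ + l₁ ℤ.- + l₂) ℕ.* fac (+ l ℤ.- + l₁ ℤ.+ + l₂)
              ℕ.* fac (+ l₁ ℤ.+ + l₂ ℤ.- + l)))
       ℚ.* recipℕ ((l₁ ℕ.+ l₂ ℕ.+ l ℕ.+ 1) !)
       ℚ.* ℕ→ℚ (fac (+ l ℤ.+ m) ℕ.* fac (+ l ℤ.- m) ℕ.* fac (+ l₁ ℤ.- m₁) ℕ.* fac (+ l₁ ℤ.+ m₁)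
                 ℕ.* fac (+ l₂ ℤ.- m₂) ℕ.* fac (+ l₂ ℤ.+ m₂))
       ℚ.* (S ℚ.* S)
  else 0ℚ
  where S = racahSum l₁ m₁ l₂ m₂ l m

{-# OPTIONS --safe #-}

-- With m₁ = l₁ only the term k = 0 survives in Racah's sum, so the squared coefficient is a ratio
-- of factorials.  With j₀ = l + l₁ − l₂, a = l₁ + l₂ − l, u = l₂ + k − l₁, v = l − k (all ≥ 0 in the
-- given range) and L = l₁ + l₂ + l = (j₀ + a) + (u + v) it reads
--   ⟨l₁ l₁ l₂ (k−l₁) | l k⟩² = (2l+1) C(j₀+a, j₀) C(u+v, u) / ((L+1) C(L, j₀+u)).
-- By Vandermonde, C(L, j₀+u) = Σⱼ C(j₀+a, j) C(u+v, j₀+u−j) has j₀+u+1 terms.  Since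
-- j₀v − au = l² + l₁² − l₂² − 2l₁k, the choice k = ⌊(l² + l₁² − l₂²)/2l₁⌋ gives 0 ≤ j₀v − au < j₀ + a,
-- which (as j₀ ≤ u) says that the ratio of consecutive terms crosses 1 at j = j₀, so the j₀-th term
-- is the largest.  Hence the squared coefficient is at least (2l+1)/((L+1)(l+k+1)) ≥ 1/l².

module Submission where

open import Defs
open import Data.Nat using (ℕ; zero; suc; _+_; _*_; _∸_; _^_; _≤_; _<_; _!; _/_; _%_; NonZero; >-nonZero; z≤n; s≤s)
open import Data.Nat.Properties
open import Data.Nat.Combinatorics using (_C_; nCk≡n!/k![n-k]!; k![n∸k]!∣n!; nCk+nC[k+1]≡[n+1]C[k+1]; k>n⇒nCk≡0)
open import Data.Nat.DivMod using (m/n*n≡m; m/n*n≤m; m%n<n; m≡m%n+[m/n]*n; m*n/m*o≡n/o; /-congˡ; /-congʳ)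
open import Data.Nat.Tactic.RingSolver using (solve-∀)
open import Data.Integer using (ℤ; +_; -[1+_]; +≤+)
import Data.Integer as ℤ
import Data.Integer.Properties as ℤP
import Data.Integer.DivMod as ℤ-DivMod
import Data.Integer.Tactic.RingSolver as ℤ-Solver
open import Data.Rational using (0ℚ; 1ℚ; floor; mkℚ)
import Data.Rational as ℚ
open import Data.Rational.Properties using (toℚᵘ-homo-*; toℚᵘ-fromℚᵘ; toℚᵘ-cancel-≤)
import Data.Rational.Properties as ℚP
open import Data.Rational.Unnormalised using (mkℚᵘ; *≡*; *≤*)
import Data.Rational.Unnormalised as ℚᵘ
import Data.Rational.Unnormalised.Properties as ℚᵘP
open import Data.Bool using (true)
open import Data.Bool.Properties using (∧-zeroʳ)
open import Data.List.Relation.Unary.All using (All; []; _∷_)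
open import Data.List.Relation.Unary.All.Properties using (map⁺; applyUpTo⁺₂)
open import Data.Product using (∃₂; _×_; _,_)
open import Data.Sum using (inj₁; inj₂)
open import Function using (_∘_)
open import Relation.Binary.PropositionalEquality
open import Relation.Nullary using (yes; no; contradiction)
import Algebra.Properties.CommutativeSemigroup as CommutativeSemigroupProperties

-- Binomial coefficients and Vandermonde's identity

[m+n]Cm*[m!*n!]≡[m+n]! : ∀ m n → ((m + n) C m) * (m ! * n !) ≡ (m + n) !
[m+n]Cm*[m!*n!]≡[m+n]! m n = begin
  ((m + n) C m) * (m ! * n !)              ≡⟨ cong (λ k → ((m + n) C m) * (m ! * k !)) (m+n∸m≡n m n) ⟨
  ((m + n) C m) * (m ! * (m + n ∸ m) !)    ≡⟨ cong (_* (m ! * (m + n ∸ m) !)) (nCk≡n!/k![n-k]! (m≤m+n m n)) ⟩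
  (m + n) ! / (m ! * (m + n ∸ m) !) * (m ! * (m + n ∸ m) !) ≡⟨ m/n*n≡m (k![n∸k]!∣n! (m≤m+n m n)) ⟩
  (m + n) !                                ∎
  where
  open ≡-Reasoning
  instance
    m!*[m+n∸m]!≢0 : NonZero (m ! * (m + n ∸ m) !)
    m!*[m+n∸m]!≢0 = m !* (m + n ∸ m) !≢0

nC[1+k]*[1+k]≡nCk*[n∸k] : ∀ n k → (n C suc k) * suc k ≡ (n C k) * (n ∸ k)
nC[1+k]*[1+k]≡nCk*[n∸k] n k with n ≤? k
... | yes n≤k = begin
  (n C suc k) * suc k   ≡⟨ cong (_* suc k) (k>n⇒nCk≡0 (s≤s n≤k)) ⟩
  0                     ≡⟨ *-zeroʳ (n C k) ⟨
  (n C k) * 0           ≡⟨ cong ((n C k) *_) (m≤n⇒m∸n≡0 n≤k) ⟨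
  (n C k) * (n ∸ k)     ∎
  where open ≡-Reasoning
... | no n≰k with m≤n⇒∃[o]m+o≡n (≰⇒> n≰k)
...   | q , refl = *-cancelʳ-≡ _ _ (k ! * q !) {{k !* q !≢0}} (begin
  (n C suc k) * suc k * (k ! * q !)         ≡⟨ regroup (n C suc k) (suc k) (k !) (q !) ⟩
  (n C suc k) * (suc k ! * q !)             ≡⟨ [m+n]Cm*[m!*n!]≡[m+n]! (suc k) q ⟩
  n !                                       ≡⟨ cong _! (+-suc k q) ⟨
  (k + suc q) !                             ≡⟨ [m+n]Cm*[m!*n!]≡[m+n]! k (suc q) ⟨
  ((k + suc q) C k) * (k ! * suc q !)       ≡⟨ cong (λ m → (m C k) * (k ! * suc q !)) (+-suc k q) ⟩
  (n C k) * (k ! * suc q !)                 ≡⟨ regroup′ (n C k) (suc q) (k !) (q !) ⟩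
  (n C k) * suc q * (k ! * q !)             ≡⟨ cong (λ m → (n C k) * m * (k ! * q !)) n∸k≡1+q ⟨
  (n C k) * (n ∸ k) * (k ! * q !)           ∎)
  where
  open ≡-Reasoning
  n∸k≡1+q : suc k + q ∸ k ≡ suc q
  n∸k≡1+q = trans (cong (_∸ k) (sym (+-suc k q))) (m+n∸m≡n k (suc q))
  regroup : ∀ x y z w → x * y * (z * w) ≡ x * (y * z * w)
  regroup = solve-∀
  regroup′ : ∀ x y z w → x * (z * (y * w)) ≡ x * y * (z * w)
  regroup′ = solve-∀

convolution : (ℕ → ℕ) → (ℕ → ℕ) → ℕ → ℕ
convolution f g zero    = f 0 * g 0
convolution f g (suc s) = f 0 * g (suc s) + convolution (f ∘ suc) g s

convolution-distribˡ-+ : ∀ f h g s → convolution (λ j → f j + h j) g s ≡ convolution f g s + convolution h g s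
convolution-distribˡ-+ f h g zero    = *-distribʳ-+ (g 0) (f 0) (h 0)
convolution-distribˡ-+ f h g (suc s) = begin
  (f 0 + h 0) * g (suc s) + convolution (λ j → f (suc j) + h (suc j)) g s
    ≡⟨ cong₂ _+_ (*-distribʳ-+ (g (suc s)) (f 0) (h 0)) (convolution-distribˡ-+ (f ∘ suc) (h ∘ suc) g s) ⟩
  (f 0 * g (suc s) + h 0 * g (suc s)) + (convolution (f ∘ suc) g s + convolution (h ∘ suc) g s)
    ≡⟨ interchange (f 0 * g (suc s)) (h 0 * g (suc s)) _ _ ⟩
  (f 0 * g (suc s) + convolution (f ∘ suc) g s) + (h 0 * g (suc s) + convolution (h ∘ suc) g s) ∎
  where
  open ≡-Reasoning
  open CommutativeSemigroupProperties +-commutativeSemigroup using (interchange)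

convolution-congˡ : ∀ {f h} g s → (∀ j → f j ≡ h j) → convolution f g s ≡ convolution h g s
convolution-congˡ g zero    f≗h = cong (_* g 0) (f≗h 0)
convolution-congˡ g (suc s) f≗h = cong₂ _+_ (cong (_* g (suc s)) (f≗h 0)) (convolution-congˡ g s (f≗h ∘ suc))

convolution-zeroˡ : ∀ g s → convolution (λ _ → 0) g s ≡ 0
convolution-zeroˡ g zero    = refl
convolution-zeroˡ g (suc s) = convolution-zeroˡ g s

vandermonde : ∀ m n s → convolution (m C_) (n C_) s ≡ (m + n) C s
vandermonde zero    n zero    = +-identityʳ (n C 0)
vandermonde zero    n (suc s) = trans (cong₂ _+_ (+-identityʳ (n C suc s)) (convolution-zeroˡ (n C_) s)) (+-identityʳ _)
vandermonde (suc m) n zero    = refl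
vandermonde (suc m) n (suc s) = begin
  1 * (n C suc s) + convolution (λ j → suc m C suc j) (n C_) s
    ≡⟨ cong (_+_ (1 * (n C suc s))) (trans (convolution-congˡ (n C_) s pascal)
                                            (convolution-distribˡ-+ (m C_) (λ j → m C suc j) (n C_) s)) ⟩
  1 * (n C suc s) + (convolution (m C_) (n C_) s + convolution (λ j → m C suc j) (n C_) s)
    ≡⟨ x∙yz≈y∙xz (1 * (n C suc s)) (convolution (m C_) (n C_) s) (convolution (λ j → m C suc j) (n C_) s) ⟩
  convolution (m C_) (n C_) s + convolution (m C_) (n C_) (suc s)
    ≡⟨ cong₂ _+_ (vandermonde m n s) (vandermonde m n (suc s)) ⟩
  ((m + n) C s) + ((m + n) C suc s)
    ≡⟨ nCk+nC[k+1]≡[n+1]C[k+1] (m + n) s ⟩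
  (suc m + n) C suc s ∎
  where
  open ≡-Reasoning
  open CommutativeSemigroupProperties +-commutativeSemigroup using (x∙yz≈y∙xz)
  pascal : ∀ j → suc m C suc j ≡ (m C j) + (m C suc j)
  pascal j = sym (nCk+nC[k+1]≡[n+1]C[k+1] m j)

convolution-≤ : ∀ f g s {B} → (∀ j r → j + r ≡ s → f j * g r ≤ B) → convolution f g s ≤ suc s * B
convolution-≤ f g zero    {B} bound = subst (f 0 * g 0 ≤_) (sym (+-identityʳ B)) (bound 0 0 refl)
convolution-≤ f g (suc s)     bound = +-mono-≤ (bound 0 (suc s) refl)
                                        (convolution-≤ (f ∘ suc) g s (λ j r → bound (suc j) r ∘ cong suc))

-- The largest term of Vandermonde's sum

module _ (T : ℕ → ℕ → ℕ) {p q : ℕ}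
         (step : ∀ {j r} → p ≤ j → j + suc r ≡ p + q → T (suc j) r ≤ T j (suc r)) where

  antidiagonal-descent : ∀ j {r} → p ≤ j → j + r ≡ p + q → T j r ≤ T p q
  antidiagonal-descent j {r} p≤j eq with m≤n⇒m<n∨m≡n p≤j
  ... | inj₂ refl = ≤-reflexive (cong (T j) (+-cancelˡ-≡ j r q eq))
  antidiagonal-descent (suc j) {r} _ eq | inj₁ (s≤s p≤j) =
    ≤-trans (step p≤j eq′) (antidiagonal-descent j p≤j eq′)
    where
    eq′ : j + suc r ≡ p + q
    eq′ = trans (+-suc j r) eq

m*n≡o*p∧p≤n⇒m≤o : ∀ {m n o p} .{{_ : NonZero n}} → m * n ≡ o * p → p ≤ n → m ≤ o
m*n≡o*p∧p≤n⇒m≤o {m} {n} {o} {p} mn≡op p≤n = *-cancelʳ-≤ m o n (begin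
  m * n ≡⟨ mn≡op ⟩
  o * p ≤⟨ *-monoʳ-≤ o p≤n ⟩
  o * n ∎)
  where open ≤-Reasoning

binomial-product-ratio : ∀ M N j r →
  (M C suc j) * (N C r) * (suc j * (N ∸ r)) ≡ (M C j) * (N C suc r) * ((M ∸ j) * suc r)
binomial-product-ratio M N j r = begin
  (M C suc j) * (N C r) * (suc j * (N ∸ r))      ≡⟨ interchange (M C suc j) (N C r) (suc j) (N ∸ r) ⟩
  ((M C suc j) * suc j) * ((N C r) * (N ∸ r))    ≡⟨ cong₂ _*_ (nC[1+k]*[1+k]≡nCk*[n∸k] M j)
                                                              (sym (nC[1+k]*[1+k]≡nCk*[n∸k] N r)) ⟩
  ((M C j) * (M ∸ j)) * ((N C suc r) * suc r)    ≡⟨ interchange (M C j) (M ∸ j) (N C suc r) (suc r) ⟩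
  (M C j) * (N C suc r) * ((M ∸ j) * suc r)      ∎
  where
  open ≡-Reasoning
  open CommutativeSemigroupProperties *-commutativeSemigroup using (interchange)

mode-dominates-tail : ∀ {j₀ a u v} → a * u ≤ suc j₀ * suc v →
  ∀ {j r} → j₀ ≤ j → j + r ≡ j₀ + u → ((j₀ + a) C j) * ((u + v) C r) ≤ ((j₀ + a) C j₀) * ((u + v) C u)
mode-dominates-tail {j₀} {a} {u} {v} au≤ {j} j₀≤j =
  antidiagonal-descent (λ j r → ((j₀ + a) C j) * ((u + v) C r)) step j j₀≤j
  where
  step : ∀ {j r} → j₀ ≤ j → j + suc r ≡ j₀ + u →
         ((j₀ + a) C suc j) * ((u + v) C r) ≤ ((j₀ + a) C j) * ((u + v) C suc r)
  step {j} {r} j₀≤j eq =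
    m*n≡o*p∧p≤n⇒m≤o {{>-nonZero 0<R}} (binomial-product-ratio (j₀ + a) (u + v) j r) Q≤R
    where
    [j₀+a]∸j≤a : j₀ + a ∸ j ≤ a
    [j₀+a]∸j≤a = subst (j₀ + a ∸ j ≤_) (m+n∸m≡n j₀ a) (∸-monoʳ-≤ (j₀ + a) j₀≤j)
    1+r≤u : suc r ≤ u
    1+r≤u = +-cancelˡ-≤ j₀ (suc r) u (≤-trans (+-monoˡ-≤ (suc r) j₀≤j) (≤-reflexive eq))
    1+v≤[u+v]∸r : suc v ≤ u + v ∸ r
    1+v≤[u+v]∸r = m+n≤o⇒m≤o∸n (suc v) (subst (_≤ u + v) (cong suc (+-comm r v)) (+-monoˡ-≤ v 1+r≤u))
    Q≤R : (j₀ + a ∸ j) * suc r ≤ suc j * (u + v ∸ r)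
    Q≤R = begin
      (j₀ + a ∸ j) * suc r   ≤⟨ *-mono-≤ [j₀+a]∸j≤a 1+r≤u ⟩
      a * u                  ≤⟨ au≤ ⟩
      suc j₀ * suc v         ≤⟨ *-mono-≤ (s≤s j₀≤j) 1+v≤[u+v]∸r ⟩
      suc j * (u + v ∸ r)    ∎
      where open ≤-Reasoning
    0<R : 0 < suc j * (u + v ∸ r)
    0<R = *-mono-≤ (s≤s (z≤n {j})) (≤-trans (s≤s z≤n) 1+v≤[u+v]∸r)

hypergeometric-mode : ∀ {j₀ a u v} → a * u ≤ suc j₀ * suc v → j₀ * v ≤ suc a * suc u →
  ∀ j r → j + r ≡ j₀ + u → ((j₀ + a) C j) * ((u + v) C r) ≤ ((j₀ + a) C j₀) * ((u + v) C u)
hypergeometric-mode {j₀} {a} {u} {v} tail head j r eq with j₀ ≤? j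
... | yes j₀≤j = mode-dominates-tail tail j₀≤j eq
... | no  j₀≰j = subst₂ _≤_ (*-comm ((u + v) C r) ((j₀ + a) C j)) (*-comm ((u + v) C u) ((j₀ + a) C j₀))
                   (mode-dominates-tail {u} {v} {j₀} {a} head′ u≤r eq′)
  where
  head′ : v * j₀ ≤ suc u * suc a
  head′ = subst₂ _≤_ (*-comm j₀ v) (*-comm (suc a) (suc u)) head
  u≤r : u ≤ r
  u≤r = +-cancelˡ-≤ j u r (≤-trans (+-monoˡ-≤ u (<⇒≤ (≰⇒> j₀≰j))) (≤-reflexive (sym eq)))
  eq′ : r + j ≡ u + j₀
  eq′ = trans (+-comm r j) (trans eq (+-comm j₀ u))

vandermonde-≤-mode : ∀ {j₀ a u v} → a * u ≤ suc j₀ * suc v → j₀ * v ≤ suc a * suc u →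
  ((j₀ + a + (u + v)) C (j₀ + u)) ≤ suc (j₀ + u) * (((j₀ + a) C j₀) * ((u + v) C u))
vandermonde-≤-mode {j₀} {a} {u} {v} tail head =
  subst (_≤ suc (j₀ + u) * (((j₀ + a) C j₀) * ((u + v) C u))) (vandermonde (j₀ + a) (u + v) (j₀ + u))
    (convolution-≤ ((j₀ + a) C_) ((u + v) C_) (j₀ + u) (hypergeometric-mode {j₀} {a} {u} {v} tail head))

-- Rational arithmetic

toℚᵘ-homo-*′ : ∀ {p q p′ q′} → ℚ.toℚᵘ p ℚᵘ.≃ p′ → ℚ.toℚᵘ q ℚᵘ.≃ q′ → ℚ.toℚᵘ (p ℚ.* q) ℚᵘ.≃ p′ ℚᵘ.* q′
toℚᵘ-homo-*′ {p} {q} p≃ q≃ = ℚᵘP.≃-trans (toℚᵘ-homo-* p q) (ℚᵘP.*-cong p≃ q≃)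

toℚᵘ-ℕ→ℚ : ∀ n → ℚ.toℚᵘ (ℕ→ℚ n) ℚᵘ.≃ mkℚᵘ (+ n) 0
toℚᵘ-ℕ→ℚ n = toℚᵘ-fromℚᵘ (mkℚᵘ (+ n) 0)

toℚᵘ-recipℕ : ∀ n → ℚ.toℚᵘ (recipℕ (suc n)) ℚᵘ.≃ mkℚᵘ (+ 1) n
toℚᵘ-recipℕ n = toℚᵘ-fromℚᵘ (mkℚᵘ (+ 1) n)

-- In ℚᵘ the product is a single unnormalised fraction, so ≤ is one cross-multiplication.
1≤fraction : ∀ A B C D X .{{_ : NonZero B}} .{{_ : NonZero D}} → B * (D * D) ≤ A * C * X →
  1ℚ ℚ.≤ ℕ→ℚ A ℚ.* recipℕ B ℚ.* ℕ→ℚ C ℚ.* (recipℕ D ℚ.* recipℕ D) ℚ.* ℕ→ℚ X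
1≤fraction A B@(suc b) C D@(suc d) X le =
  toℚᵘ-cancel-≤ (ℚᵘP.≤-respʳ-≃ (ℚᵘP.≃-sym as-ℚᵘ) (*≤* (subst₂ ℤ._≤_ denominator numerator (+≤+ le))))
  where
  as-ℚᵘ : ℚ.toℚᵘ (ℕ→ℚ A ℚ.* recipℕ B ℚ.* ℕ→ℚ C ℚ.* (recipℕ D ℚ.* recipℕ D) ℚ.* ℕ→ℚ X) ℚᵘ.≃
          mkℚᵘ (+ A) 0 ℚᵘ.* mkℚᵘ (+ 1) b ℚᵘ.* mkℚᵘ (+ C) 0 ℚᵘ.* (mkℚᵘ (+ 1) d ℚᵘ.* mkℚᵘ (+ 1) d) ℚᵘ.* mkℚᵘ (+ X) 0
  as-ℚᵘ = toℚᵘ-homo-*′ (toℚᵘ-homo-*′ (toℚᵘ-homo-*′ (toℚᵘ-homo-*′ (toℚᵘ-ℕ→ℚ A) (toℚᵘ-recipℕ b)) (toℚᵘ-ℕ→ℚ C))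
                         (toℚᵘ-homo-*′ (toℚᵘ-recipℕ d) (toℚᵘ-recipℕ d))) (toℚᵘ-ℕ→ℚ X)
  numerator : + (A * C * X) ≡ (((+ A ℤ.* + 1) ℤ.* + C) ℤ.* (+ 1 ℤ.* + 1)) ℤ.* + X ℤ.* + 1
  numerator = trans (trans (ℤP.pos-* (A * C) X) (cong (ℤ._* + X) (ℤP.pos-* A C))) (units (+ A) (+ C) (+ X))
    where
    units : ∀ a c x → a ℤ.* c ℤ.* x ≡ (((a ℤ.* + 1) ℤ.* c) ℤ.* (+ 1 ℤ.* + 1)) ℤ.* x ℤ.* + 1
    units = ℤ-Solver.solve-∀
  denominator : + (B * (D * D)) ≡ + 1 ℤ.* ((((+ 1 ℤ.* + B) ℤ.* + 1) ℤ.* (+ D ℤ.* + D)) ℤ.* + 1)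
  denominator = trans (trans (ℤP.pos-* B (D * D)) (cong (+ B ℤ.*_) (ℤP.pos-* D D))) (units (+ B) (+ D))
    where
    units : ∀ b d → b ℤ.* (d ℤ.* d) ≡ + 1 ℤ.* ((((+ 1 ℤ.* b) ℤ.* + 1) ℤ.* (d ℤ.* d)) ℤ.* + 1)
    units = ℤ-Solver.solve-∀

floor-ℕ-fraction : ∀ w n .{{_ : NonZero n}} → floor ((+ w ℚ./ 1) ℚ.* recipℕ n) ≡ + (w / n)
floor-ℕ-fraction w n@(suc n-1) = floor-of-≃ _ (toℚᵘ-homo-*′ (toℚᵘ-ℕ→ℚ w) (toℚᵘ-recipℕ n-1))
  where
  floor-of-≃ : ∀ p → ℚ.toℚᵘ p ℚᵘ.≃ mkℚᵘ (+ w) 0 ℚᵘ.* mkℚᵘ (+ 1) n-1 → floor p ≡ + (w / n)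
  floor-of-≃ (mkℚ (+ x) d-1 _) (*≡* eq) =
    trans (ℤ-DivMod.div-pos-is-/ℕ (+ x) d) (cong +_ (begin
      x / d              ≡⟨ m*n/m*o≡n/o n x d ⟨
      (n * x) / (n * d)  ≡⟨ /-congˡ (trans (*-comm n x) (trans cross (*-comm w d))) ⟩
      (d * w) / (n * d)  ≡⟨ /-congʳ {m = d * w} (*-comm n d) ⟩
      (d * w) / (d * n)  ≡⟨ m*n/m*o≡n/o d w n ⟩
      w / n              ∎))
    where
    open ≡-Reasoning
    d : ℕ
    d = suc d-1
    cross : x * n ≡ w * d
    cross = ℤP.+-injective (begin
      + (x * n)                ≡⟨ ℤP.pos-* x n ⟩
      + x ℤ.* + n              ≡⟨ cong (ℤ._*_ (+ x)) (ℤP.*-identityˡ (+ n)) ⟨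
      + x ℤ.* (+ 1 ℤ.* + n)    ≡⟨ eq ⟩
      (+ w ℤ.* + 1) ℤ.* + d    ≡⟨ cong (ℤ._* + d) (ℤP.*-identityʳ (+ w)) ⟩
      + w ℤ.* + d              ≡⟨ ℤP.pos-* w d ⟨
      + (w * d)                ∎)
  floor-of-≃ (mkℚ -[1+ x ] d-1 _) (*≡* eq) =
    contradiction (trans eq (trans (cong (ℤ._* + suc d-1) (ℤP.*-identityʳ (+ w))) (sym (ℤP.pos-* w (suc d-1))))) λ ()

-- Racah's formula at m₁ = l₁

sumℚ-zero : ∀ {xs} → All (_≡ 0ℚ) xs → sumℚ xs ≡ 0ℚ
sumℚ-zero []           = refl
sumℚ-zero (refl ∷ xs≡0) = cong (0ℚ ℚ.+_) (sumℚ-zero xs≡0)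

-- the factorial argument l₁ − m₁ − k is negative
racahTerm-m₁≡l₁-vanishes : ∀ l₁ l₂ m₂ l m i → racahTerm (+ l₁) (+ l₁) l₂ m₂ l m (suc i) ≡ 0ℚ
racahTerm-m₁≡l₁-vanishes l₁ l₂ m₂ l m i
  rewrite ℤP.+-inverseʳ (+ l₁) | ∧-zeroʳ (nonneg (+ l₁ ℤ.+ l₂ ℤ.- l ℤ.- + suc i)) = refl

racahSum-m₁≡l₁ : ∀ l₁ l₂ m₂ l m → racahSum l₁ (+ l₁) l₂ m₂ l m ≡ racahTerm (+ l₁) (+ l₁) (+ l₂) m₂ (+ l) m 0 ℚ.+ 0ℚ
racahSum-m₁≡l₁ l₁ l₂ m₂ l m = cong (racahTerm (+ l₁) (+ l₁) (+ l₂) m₂ (+ l) m 0 ℚ.+_)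
  (sumℚ-zero (map⁺ (applyUpTo⁺₂ suc (l₁ + l₂ + l) (racahTerm-m₁≡l₁-vanishes l₁ (+ l₂) m₂ (+ l) m))))

racahTerm-0 : ∀ {l₁ m₁ l₂ m₂ l m n₁ n₂ n₃ n₄ n₅} →
  l₁ ℤ.+ l₂ ℤ.- l ≡ + n₁ → l₁ ℤ.- m₁ ≡ + n₂ → l₂ ℤ.+ m₂ ≡ + n₃ →
  l ℤ.- l₂ ℤ.+ m₁ ≡ + n₄ → l ℤ.- l₁ ℤ.- m₂ ≡ + n₅ →
  racahTerm l₁ m₁ l₂ m₂ l m 0 ≡ 1ℚ ℚ.* recipℕ (1 * n₁ ! * n₂ ! * n₃ ! * n₄ ! * n₅ !)
racahTerm-0 {l₁} {m₁} {l₂} {m₂} {l} e₁ e₂ e₃ e₄ e₅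
  rewrite ℤP.+-identityʳ (l₁ ℤ.+ l₂ ℤ.- l) | ℤP.+-identityʳ (l₁ ℤ.- m₁) | ℤP.+-identityʳ (l₂ ℤ.+ m₂)
        | ℤP.+-identityʳ (l ℤ.- l₂ ℤ.+ m₁) | ℤP.+-identityʳ (l ℤ.- l₁ ℤ.- m₂)
        | e₁ | e₂ | e₃ | e₄ | e₅ = refl

==ℤ-refl : ∀ x → x ==ℤ x ≡ true
==ℤ-refl x rewrite ℤP.+-inverseʳ x = refl

racahSum-stretched : ∀ l₁ l₂ l m₂ m {j₀ a u v : ℕ} →
  + l₁ ℤ.+ m₂ ≡ m → + l ℤ.+ + l₁ ℤ.- + l₂ ≡ + j₀ → + l₁ ℤ.+ + l₂ ℤ.- + l ≡ + a →
  + l₂ ℤ.+ m₂ ≡ + u → + l ℤ.- m ≡ + v →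
  racahSum l₁ (+ l₁) l₂ m₂ l m ≡ recipℕ (a ! * 0 ! * u ! * j₀ ! * v !)
racahSum-stretched l₁ l₂ l m₂ m {j₀} {a} {u} {v} m≡ j₀≡ a≡ u≡ v≡ = begin
  racahSum l₁ (+ l₁) l₂ m₂ l m
    ≡⟨ racahSum-m₁≡l₁ l₁ l₂ m₂ l m ⟩
  racahTerm (+ l₁) (+ l₁) (+ l₂) m₂ (+ l) m 0 ℚ.+ 0ℚ
    ≡⟨ ℚP.+-identityʳ _ ⟩
  racahTerm (+ l₁) (+ l₁) (+ l₂) m₂ (+ l) m 0
    ≡⟨ racahTerm-0 {+ l₁} {+ l₁} {+ l₂} {m₂} {+ l} {m} a≡ (ℤP.+-inverseʳ (+ l₁)) u≡ j₀≡′ v≡′ ⟩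
  1ℚ ℚ.* recipℕ (1 * a ! * 0 ! * u ! * j₀ ! * v !)
    ≡⟨ ℚP.*-identityˡ _ ⟩
  recipℕ (1 * a ! * 0 ! * u ! * j₀ ! * v !)
    ≡⟨ cong (λ x → recipℕ (x * 0 ! * u ! * j₀ ! * v !)) (*-identityˡ (a !)) ⟩
  recipℕ (a ! * 0 ! * u ! * j₀ ! * v !) ∎
  where
  open ≡-Reasoning
  j₀≡′ : + l ℤ.- + l₂ ℤ.+ + l₁ ≡ + j₀
  j₀≡′ = trans (reorder (+ l) (+ l₁) (+ l₂)) j₀≡
    where
    reorder : ∀ x y z → x ℤ.- z ℤ.+ y ≡ x ℤ.+ y ℤ.- z
    reorder = ℤ-Solver.solve-∀
  v≡′ : + l ℤ.- + l₁ ℤ.- m₂ ≡ + v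
  v≡′ = trans (trans (reassoc (+ l) (+ l₁) m₂) (cong (ℤ._-_ (+ l)) m≡)) v≡
    where
    reassoc : ∀ x y z → x ℤ.- y ℤ.- z ≡ x ℤ.- (y ℤ.+ z)
    reassoc = ℤ-Solver.solve-∀

CGsq-stretched : ∀ l₁ l₂ l m₂ m {j₀ n a av u v s : ℕ} →
  + l₁ ℤ.+ m₂ ≡ m →
  + l ℤ.+ + l₁ ℤ.- + l₂ ≡ + j₀ → + l ℤ.- + l₁ ℤ.+ + l₂ ≡ + n → + l₁ ℤ.+ + l₂ ℤ.- + l ≡ + a →
  + l₂ ℤ.- m₂ ≡ + av → + l₂ ℤ.+ m₂ ≡ + u → + l ℤ.- m ≡ + v → + l ℤ.+ m ≡ + s →
  CGsq l₁ (+ l₁) l₂ m₂ l m ≡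
    ℕ→ℚ ((2 * l + 1) * j₀ ! * n ! * a !) ℚ.* recipℕ ((l₁ + l₂ + l + 1) !)
    ℚ.* ℕ→ℚ (s ! * v ! * 0 ! * (l₁ + l₁) ! * av ! * u !)
    ℚ.* (racahSum l₁ (+ l₁) l₂ m₂ l m ℚ.* racahSum l₁ (+ l₁) l₂ m₂ l m)
CGsq-stretched l₁ l₂ l m₂ m {j₀} {n} {a} {av} {u} {v} {s} m≡ j₀≡ n≡ a≡ av≡ u≡ v≡ s≡
  rewrite m≡ | ==ℤ-refl m | ℤP.+-inverseʳ (+ l₁) | j₀≡ | n≡ | a≡ | av≡ | u≡ | v≡ | s≡ = refl

pos-∸ : ∀ {m n} → n ≤ m → + (m ∸ n) ≡ + m ℤ.- + n
pos-∸ {m} {n} n≤m = sym (trans (ℤP.[+m]-[+n]≡m⊖n m n) (ℤP.⊖-≥ n≤m))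

module Stretched {l₁ l₂ l K : ℕ}
  (l₂≤l+l₁ : l₂ ≤ l + l₁) (l≤l₁+l₂ : l ≤ l₁ + l₂) (l₁≤l₂+K : l₁ ≤ l₂ + K) (K≤l : K ≤ l) where

  j₀ a u v : ℕ
  j₀ = l + l₁ ∸ l₂
  a  = l₁ + l₂ ∸ l
  u  = l₂ + K ∸ l₁
  v  = l ∸ K

  m₂ : ℤ
  m₂ = + K ℤ.- + l₁

  private
    j₀-def : + j₀ ≡ + l ℤ.+ + l₁ ℤ.- + l₂
    j₀-def = pos-∸ l₂≤l+l₁
    a-def : + a ≡ + l₁ ℤ.+ + l₂ ℤ.- + l
    a-def = pos-∸ l≤l₁+l₂
    u-def : + u ≡ + l₂ ℤ.+ + K ℤ.- + l₁
    u-def = pos-∸ l₁≤l₂+K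
    v-def : + v ≡ + l ℤ.- + K
    v-def = pos-∸ K≤l

    l₁+m₂≡K : + l₁ ℤ.+ m₂ ≡ + K
    l₁+m₂≡K = ring (+ l₁) (+ K)
      where
      ring : ∀ x y → x ℤ.+ (y ℤ.- x) ≡ y
      ring = ℤ-Solver.solve-∀

    l₂+m₂≡u : + l₂ ℤ.+ m₂ ≡ + u
    l₂+m₂≡u = trans (ring (+ l₂) (+ K) (+ l₁)) (sym u-def)
      where
      ring : ∀ x y z → x ℤ.+ (y ℤ.- z) ≡ x ℤ.+ y ℤ.- z
      ring = ℤ-Solver.solve-∀

    l₂-m₂≡a+v : + l₂ ℤ.- m₂ ≡ + (a + v)
    l₂-m₂≡a+v = trans (ring (+ l₁) (+ l₂) (+ l) (+ K)) (sym (cong₂ ℤ._+_ a-def v-def))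
      where
      ring : ∀ x y z w → y ℤ.- (w ℤ.- x) ≡ (x ℤ.+ y ℤ.- z) ℤ.+ (z ℤ.- w)
      ring = ℤ-Solver.solve-∀

    l-l₁+l₂≡u+v : + l ℤ.- + l₁ ℤ.+ + l₂ ≡ + (u + v)
    l-l₁+l₂≡u+v = trans (ring (+ l₁) (+ l₂) (+ l) (+ K)) (sym (cong₂ ℤ._+_ u-def v-def))
      where
      ring : ∀ x y z w → z ℤ.- x ℤ.+ y ≡ (y ℤ.+ w ℤ.- x) ℤ.+ (z ℤ.- w)
      ring = ℤ-Solver.solve-∀

    l₁+l₁≡j₀+a : l₁ + l₁ ≡ j₀ + a
    l₁+l₁≡j₀+a = ℤP.+-injective (trans (ring (+ l₁) (+ l₂) (+ l)) (sym (cong₂ ℤ._+_ j₀-def a-def)))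
      where
      ring : ∀ x y z → x ℤ.+ x ≡ (z ℤ.+ x ℤ.- y) ℤ.+ (x ℤ.+ y ℤ.- z)
      ring = ℤ-Solver.solve-∀

    l+K≡j₀+u : l + K ≡ j₀ + u
    l+K≡j₀+u = ℤP.+-injective (trans (ring (+ l₁) (+ l₂) (+ l) (+ K)) (sym (cong₂ ℤ._+_ j₀-def u-def)))
      where
      ring : ∀ x y z w → z ℤ.+ w ≡ (z ℤ.+ x ℤ.- y) ℤ.+ (y ℤ.+ w ℤ.- x)
      ring = ℤ-Solver.solve-∀

    l₁+l₂+l≡[j₀+a]+[u+v] : l₁ + l₂ + l ≡ j₀ + a + (u + v)
    l₁+l₂+l≡[j₀+a]+[u+v] =
      trans (ℤP.+-injective (trans (ring (+ l₁) (+ l₂) (+ l)) (cong (ℤ._+_ (+ (l₁ + l₁))) l-l₁+l₂≡u+v)))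
            (cong (λ m → m + (u + v)) l₁+l₁≡j₀+a)
      where
      ring : ∀ x y z → x ℤ.+ y ℤ.+ z ≡ (x ℤ.+ x) ℤ.+ (z ℤ.- x ℤ.+ y)
      ring = ℤ-Solver.solve-∀

  key-identity : a * u + (l * l + l₁ * l₁) ≡ j₀ * v + (K * (2 * l₁) + l₂ * l₂)
  key-identity = ℤP.+-injective (begin
    + (a * u) ℤ.+ (+ (l * l) ℤ.+ + (l₁ * l₁))
      ≡⟨ cong₂ ℤ._+_ (ℤP.pos-* a u) (cong₂ ℤ._+_ (ℤP.pos-* l l) (ℤP.pos-* l₁ l₁)) ⟩
    + a ℤ.* + u ℤ.+ (+ l ℤ.* + l ℤ.+ + l₁ ℤ.* + l₁)
      ≡⟨ cong₂ (λ x y → x ℤ.* y ℤ.+ (+ l ℤ.* + l ℤ.+ + l₁ ℤ.* + l₁)) a-def u-def ⟩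
    (+ l₁ ℤ.+ + l₂ ℤ.- + l) ℤ.* (+ l₂ ℤ.+ + K ℤ.- + l₁) ℤ.+ (+ l ℤ.* + l ℤ.+ + l₁ ℤ.* + l₁)
      ≡⟨ ring (+ l₁) (+ l₂) (+ l) (+ K) ⟩
    (+ l ℤ.+ + l₁ ℤ.- + l₂) ℤ.* (+ l ℤ.- + K) ℤ.+ (+ K ℤ.* (+ 2 ℤ.* + l₁) ℤ.+ + l₂ ℤ.* + l₂)
      ≡⟨ cong₂ (λ x y → x ℤ.* y ℤ.+ (+ K ℤ.* (+ 2 ℤ.* + l₁) ℤ.+ + l₂ ℤ.* + l₂)) j₀-def v-def ⟨
    + j₀ ℤ.* + v ℤ.+ (+ K ℤ.* (+ 2 ℤ.* + l₁) ℤ.+ + l₂ ℤ.* + l₂)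
      ≡⟨ cong₂ ℤ._+_ (ℤP.pos-* j₀ v)
           (cong₂ ℤ._+_ (trans (ℤP.pos-* K (2 * l₁)) (cong (ℤ._*_ (+ K)) (ℤP.pos-* 2 l₁))) (ℤP.pos-* l₂ l₂)) ⟨
    + (j₀ * v) ℤ.+ (+ (K * (2 * l₁)) ℤ.+ + (l₂ * l₂)) ∎)
    where
    open ≡-Reasoning
    ring : ∀ x y z w → (x ℤ.+ y ℤ.- z) ℤ.* (y ℤ.+ w ℤ.- x) ℤ.+ (z ℤ.* z ℤ.+ x ℤ.* x)
                     ≡ (z ℤ.+ x ℤ.- y) ℤ.* (z ℤ.- w) ℤ.+ (w ℤ.* (+ 2 ℤ.* x) ℤ.+ y ℤ.* y)
    ring = ℤ-Solver.solve-∀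

  mode-conditions : K * (2 * l₁) + l₂ * l₂ ≤ l * l + l₁ * l₁ → l * l + l₁ * l₁ < K * (2 * l₁) + 2 * l₁ + l₂ * l₂ →
                    j₀ ≤ suc u → a * u ≤ suc j₀ * suc v × j₀ * v ≤ suc a * suc u
  mode-conditions lower upper j₀≤1+u =
    ≤-trans au≤j₀v (*-mono-≤ (n≤1+n j₀) (n≤1+n v)) , <⇒≤ (<-≤-trans j₀v<au+j₀+a au+j₀+a≤[1+a][1+u])
    where
    open ≤-Reasoning
    W : ℕ
    W = K * (2 * l₁) + l₂ * l₂
    au≤j₀v : a * u ≤ j₀ * v
    au≤j₀v = +-cancelʳ-≤ W (a * u) (j₀ * v) (begin
      a * u + W                    ≤⟨ +-monoʳ-≤ (a * u) lower ⟩
      a * u + (l * l + l₁ * l₁)    ≡⟨ key-identity ⟩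
      j₀ * v + W                   ∎)
    j₀v<au+j₀+a : j₀ * v < a * u + (j₀ + a)
    j₀v<au+j₀+a = +-cancelʳ-< W (j₀ * v) (a * u + (j₀ + a)) (begin-strict
      j₀ * v + W                               ≡⟨ key-identity ⟨
      a * u + (l * l + l₁ * l₁)                <⟨ +-monoʳ-< (a * u) upper ⟩
      a * u + (K * (2 * l₁) + 2 * l₁ + l₂ * l₂) ≡⟨ regroup (a * u) (K * (2 * l₁)) (2 * l₁) (l₂ * l₂) ⟩
      a * u + 2 * l₁ + W                       ≡⟨ cong (λ m → a * u + m + W) (trans (two l₁) l₁+l₁≡j₀+a) ⟩
      a * u + (j₀ + a) + W                     ∎)
      where
      regroup : ∀ x y z w → x + (y + z + w) ≡ x + z + (y + w)
      regroup = solve-∀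
      two : ∀ x → 2 * x ≡ x + x
      two = solve-∀
    au+j₀+a≤[1+a][1+u] : a * u + (j₀ + a) ≤ suc a * suc u
    au+j₀+a≤[1+a][1+u] = begin
      a * u + (j₀ + a)       ≤⟨ +-monoʳ-≤ (a * u) (+-monoˡ-≤ a j₀≤1+u) ⟩
      a * u + (suc u + a)    ≡⟨ expand a u ⟩
      suc a * suc u          ∎
      where
      expand : ∀ a u → a * u + (suc u + a) ≡ suc a * suc u
      expand = solve-∀

  j₀≤u : l + l₁ + l₁ ≤ l₂ + l₂ → j₀ ≤ u
  j₀≤u l+2l₁≤2l₂ = +-cancelʳ-≤ (l₂ + l₁) j₀ u (begin
    j₀ + (l₂ + l₁)      ≡⟨ +-assoc j₀ l₂ l₁ ⟨
    j₀ + l₂ + l₁        ≡⟨ cong (λ m → m + l₁) (m∸n+n≡m l₂≤l+l₁) ⟩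
    l + l₁ + l₁         ≤⟨ l+2l₁≤2l₂ ⟩
    l₂ + l₂             ≤⟨ +-monoʳ-≤ l₂ (m≤m+n l₂ K) ⟩
    l₂ + (l₂ + K)       ≡⟨ cong (_+_ l₂) (m∸n+n≡m l₁≤l₂+K) ⟨
    l₂ + (u + l₁)       ≡⟨ x∙yz≈y∙xz l₂ u l₁ ⟩
    u + (l₂ + l₁)       ∎)
    where
    open ≤-Reasoning
    open CommutativeSemigroupProperties +-commutativeSemigroup using (x∙yz≈y∙xz)

  private
    Δ-numerator Π L s P D F : ℕ
    Δ-numerator = (2 * l + 1) * j₀ ! * (u + v) ! * a !
    Π = (l + K) ! * v ! * 0 ! * (l₁ + l₁) ! * (a + v) ! * u !
    L = j₀ + a + (u + v)
    s = j₀ + u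
    P = ((j₀ + a) C j₀) * ((u + v) C u)
    D = a ! * 0 ! * u ! * j₀ ! * v !
    F = s ! * (a + v) ! * (D * D)

    CGsq-factorials : CGsq l₁ (+ l₁) l₂ m₂ l (+ K) ≡
      ℕ→ℚ Δ-numerator ℚ.* recipℕ ((l₁ + l₂ + l + 1) !) ℚ.* ℕ→ℚ Π ℚ.* (recipℕ D ℚ.* recipℕ D)
    CGsq-factorials = begin
      CGsq l₁ (+ l₁) l₂ m₂ l (+ K)
        ≡⟨ CGsq-stretched l₁ l₂ l m₂ (+ K) l₁+m₂≡K (sym j₀-def) l-l₁+l₂≡u+v (sym a-def)
                          l₂-m₂≡a+v l₂+m₂≡u (sym v-def) refl ⟩
      ℕ→ℚ Δ-numerator ℚ.* recipℕ ((l₁ + l₂ + l + 1) !) ℚ.* ℕ→ℚ Π ℚ.* (S ℚ.* S)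
        ≡⟨ cong (λ R → ℕ→ℚ Δ-numerator ℚ.* recipℕ ((l₁ + l₂ + l + 1) !) ℚ.* ℕ→ℚ Π ℚ.* (R ℚ.* R))
                (racahSum-stretched l₁ l₂ l m₂ (+ K) l₁+m₂≡K (sym j₀-def) (sym a-def) l₂+m₂≡u (sym v-def)) ⟩
      ℕ→ℚ Δ-numerator ℚ.* recipℕ ((l₁ + l₂ + l + 1) !) ℚ.* ℕ→ℚ Π ℚ.* (recipℕ D ℚ.* recipℕ D) ∎
      where
      open ≡-Reasoning
      S : ℚ.ℚ
      S = racahSum l₁ (+ l₁) l₂ m₂ l (+ K)

    denominator-factorials : (l₁ + l₂ + l + 1) ! * (D * D) ≡ suc L * (L C s) * F
    denominator-factorials = begin
      (l₁ + l₂ + l + 1) ! * (D * D)                      ≡⟨ cong (λ n → n ! * (D * D)) L+1≡ ⟩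
      suc L * L ! * (D * D)                              ≡⟨ cong (λ n → suc L * n * (D * D)) L!≡ ⟩
      suc L * ((L C s) * (s ! * (a + v) !)) * (D * D)    ≡⟨ regroup (suc L) (L C s) (s ! * (a + v) !) (D * D) ⟩
      suc L * (L C s) * F                                ∎
      where
      open ≡-Reasoning
      L+1≡ : l₁ + l₂ + l + 1 ≡ suc L
      L+1≡ = trans (+-comm (l₁ + l₂ + l) 1) (cong suc l₁+l₂+l≡[j₀+a]+[u+v])
      L!≡ : L ! ≡ (L C s) * (s ! * (a + v) !)
      L!≡ = sym (subst (λ n → (n C s) * (s ! * (a + v) !) ≡ n !) (sym (shuffle j₀ a u v))
                       ([m+n]Cm*[m!*n!]≡[m+n]! s (a + v)))
        where
        shuffle : ∀ j₀ a u v → j₀ + a + (u + v) ≡ j₀ + u + (a + v)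
        shuffle = solve-∀
      regroup : ∀ x y z w → x * (y * z) * w ≡ x * y * (z * w)
      regroup = solve-∀

    numerator-factorials : ∀ X → Δ-numerator * Π * X ≡ (2 * l + 1) * P * X * F
    numerator-factorials X = begin
      (2 * l + 1) * j₀ ! * (u + v) ! * a ! * ((l + K) ! * v ! * 0 ! * (l₁ + l₁) ! * (a + v) ! * u !) * X
        ≡⟨ cong₂ (λ m n → (2 * l + 1) * j₀ ! * (u + v) ! * a ! * (m ! * v ! * 0 ! * n ! * (a + v) ! * u !) * X)
                 l+K≡j₀+u l₁+l₁≡j₀+a ⟩
      (2 * l + 1) * j₀ ! * (u + v) ! * a ! * (s ! * v ! * 0 ! * (j₀ + a) ! * (a + v) ! * u !) * X
        ≡⟨ cong₂ (λ m n → (2 * l + 1) * j₀ ! * m * a ! * (s ! * v ! * 0 ! * n * (a + v) ! * u !) * X)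
                 ([m+n]Cm*[m!*n!]≡[m+n]! u v) ([m+n]Cm*[m!*n!]≡[m+n]! j₀ a) ⟨
      (2 * l + 1) * j₀ ! * (((u + v) C u) * (u ! * v !)) * a !
        * (s ! * v ! * 0 ! * (((j₀ + a) C j₀) * (j₀ ! * a !)) * (a + v) ! * u !) * X
        ≡⟨ regroup (2 * l + 1) ((j₀ + a) C j₀) ((u + v) C u) X (s !) ((a + v) !) (a !) (u !) (j₀ !) (v !) ⟩
      (2 * l + 1) * P * X * F ∎
      where
      open ≡-Reasoning
      regroup : ∀ c bM bN x fs fav fa fu fj fv →
        c * fj * (bN * (fu * fv)) * fa * (fs * fv * 1 * (bM * (fj * fa)) * fav * fu) * x
        ≡ c * (bM * bN) * x * (fs * fav * ((fa * 1 * fu * fj * fv) * (fa * 1 * fu * fj * fv)))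
      regroup = solve-∀

  1≤CGsq*X : ∀ X → suc L * (L C s) ≤ (2 * l + 1) * P * X → 1ℚ ℚ.≤ CGsq l₁ (+ l₁) l₂ m₂ l (+ K) ℚ.* ℕ→ℚ X
  1≤CGsq*X X hyp = subst (λ q → 1ℚ ℚ.≤ q ℚ.* ℕ→ℚ X) (sym CGsq-factorials)
    (1≤fraction Δ-numerator ((l₁ + l₂ + l + 1) !) Π D X {{(l₁ + l₂ + l + 1) !≢0}} {{>-nonZero 0<D}}
      (begin
      (l₁ + l₂ + l + 1) ! * (D * D)   ≡⟨ denominator-factorials ⟩
      suc L * (L C s) * F             ≤⟨ *-monoˡ-≤ F hyp ⟩
      (2 * l + 1) * P * X * F         ≡⟨ numerator-factorials X ⟨
      Δ-numerator * Π * X             ∎))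
    where
    open ≤-Reasoning
    0<D : 0 < D
    0<D = *-mono-≤ (*-mono-≤ (*-mono-≤ (*-mono-≤ (1≤n! a) (1≤n! 0)) (1≤n! u)) (1≤n! j₀)) (1≤n! v)

  CGsq-lower-bound : K * (2 * l₁) + l₂ * l₂ ≤ l * l + l₁ * l₁ → l * l + l₁ * l₁ < K * (2 * l₁) + 2 * l₁ + l₂ * l₂ →
                     l + l₁ + l₁ ≤ l₂ + l₂ → ∀ X → suc (l₁ + l₂ + l) * suc (l + K) ≤ (2 * l + 1) * X →
                     1ℚ ℚ.≤ CGsq l₁ (+ l₁) l₂ m₂ l (+ K) ℚ.* ℕ→ℚ X
  CGsq-lower-bound lower upper l+2l₁≤2l₂ X size
    with mode-conditions lower upper (≤-trans (j₀≤u l+2l₁≤2l₂) (n≤1+n u))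
  ... | tail , head = 1≤CGsq*X X (begin
    suc L * (L C s)                       ≤⟨ *-monoʳ-≤ (suc L) (vandermonde-≤-mode {j₀} {a} {u} {v} tail head) ⟩
    suc L * (suc s * P)                   ≡⟨ *-assoc (suc L) (suc s) P ⟨
    suc L * suc s * P                     ≡⟨ cong₂ (λ m n → suc m * suc n * P) l₁+l₂+l≡[j₀+a]+[u+v] l+K≡j₀+u ⟨
    suc (l₁ + l₂ + l) * suc (l + K) * P   ≤⟨ *-monoˡ-≤ P size ⟩
    (2 * l + 1) * X * P                   ≡⟨ xy∙z≈xz∙y (2 * l + 1) X P ⟩
    (2 * l + 1) * P * X                   ∎)
    where
    open ≤-Reasoning
    open CommutativeSemigroupProperties *-commutativeSemigroup using (xy∙z≈xz∙y)

-- The choice of k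

l²+l₁²≤2ll₁+l₂² : ∀ {l l₁ l₂} → l₁ ≤ l → l ≤ l₁ + l₂ → l * l + l₁ * l₁ ≤ l * (2 * l₁) + l₂ * l₂
l²+l₁²≤2ll₁+l₂² {l} {l₁} {l₂} l₁≤l l≤l₁+l₂ with m≤n⇒∃[o]m+o≡n l₁≤l
... | t , refl = begin
  (l₁ + t) * (l₁ + t) + l₁ * l₁     ≡⟨ expand l₁ t ⟩
  (l₁ + t) * (2 * l₁) + t * t       ≤⟨ +-monoʳ-≤ ((l₁ + t) * (2 * l₁)) (*-mono-≤ t≤l₂ t≤l₂) ⟩
  (l₁ + t) * (2 * l₁) + l₂ * l₂     ∎
  where
  open ≤-Reasoning
  t≤l₂ : t ≤ l₂
  t≤l₂ = +-cancelˡ-≤ l₁ t l₂ l≤l₁+l₂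
  expand : ∀ x t → (x + t) * (x + t) + x * x ≡ (x + t) * (2 * x) + t * t
  expand = solve-∀

module FloorChoice {l l₁ l₂ : ℕ} (0<l₁ : 0 < l₁) (l₁<l : l₁ < l) (l₂≤l : l₂ ≤ l) (l≤l₁+l₂ : l ≤ l₁ + l₂)
                   (l+2l₁≤2l₂ : l + l₁ + l₁ ≤ l₂ + l₂) where

  instance
    2l₁≢0 : NonZero (2 * l₁)
    2l₁≢0 = >-nonZero (*-mono-≤ (s≤s (z≤n {1})) 0<l₁)

  w K : ℕ
  w = l * l + l₁ * l₁ ∸ l₂ * l₂
  K = w / (2 * l₁)

  private
    l₂²≤l²+l₁² : l₂ * l₂ ≤ l * l + l₁ * l₁
    l₂²≤l²+l₁² = ≤-trans (*-mono-≤ l₂≤l l₂≤l) (m≤m+n (l * l) (l₁ * l₁))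

    w+l₂²≡l²+l₁² : w + l₂ * l₂ ≡ l * l + l₁ * l₁
    w+l₂²≡l²+l₁² = m∸n+n≡m l₂²≤l²+l₁²

  floor≡K : floor ((+ (l * l + l₁ * l₁) ℤ.- + (l₂ * l₂)) ℚ./ 1 ℚ.* recipℕ (2 * l₁)) ≡ + K
  floor≡K = trans (cong (λ x → floor (x ℚ./ 1 ℚ.* recipℕ (2 * l₁))) (sym (pos-∸ l₂²≤l²+l₁²)))
                  (floor-ℕ-fraction w (2 * l₁))

  lower : K * (2 * l₁) + l₂ * l₂ ≤ l * l + l₁ * l₁
  lower = subst (K * (2 * l₁) + l₂ * l₂ ≤_) w+l₂²≡l²+l₁² (+-monoˡ-≤ (l₂ * l₂) (m/n*n≤m w (2 * l₁)))

  upper : l * l + l₁ * l₁ < K * (2 * l₁) + 2 * l₁ + l₂ * l₂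
  upper = subst (_< K * (2 * l₁) + 2 * l₁ + l₂ * l₂) w+l₂²≡l²+l₁² (+-monoˡ-< (l₂ * l₂) (begin-strict
    w                               ≡⟨ m≡m%n+[m/n]*n w (2 * l₁) ⟩
    w % (2 * l₁) + K * (2 * l₁)     <⟨ +-monoˡ-< (K * (2 * l₁)) (m%n<n w (2 * l₁)) ⟩
    2 * l₁ + K * (2 * l₁)           ≡⟨ +-comm (2 * l₁) (K * (2 * l₁)) ⟩
    K * (2 * l₁) + 2 * l₁           ∎))
    where open ≤-Reasoning

  K≤l : K ≤ l
  K≤l = *-cancelʳ-≤ K l (2 * l₁) (+-cancelʳ-≤ (l₂ * l₂) (K * (2 * l₁)) (l * (2 * l₁)) (begin
    K * (2 * l₁) + l₂ * l₂          ≤⟨ lower ⟩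
    l * l + l₁ * l₁                 ≤⟨ l²+l₁²≤2ll₁+l₂² (<⇒≤ l₁<l) l≤l₁+l₂ ⟩
    l * (2 * l₁) + l₂ * l₂          ∎))
    where open ≤-Reasoning

  CGsq-at-floor-bound : 3 ≤ l → 1ℚ ℚ.≤ CGsq l₁ (+ l₁) l₂ (+ K ℤ.- + l₁) l (+ K) ℚ.* ℕ→ℚ (l ^ 2)
  CGsq-at-floor-bound 3≤l =
    Stretched.CGsq-lower-bound (≤-trans l₂≤l (m≤m+n l l₁)) l≤l₁+l₂ (≤-trans l₁≤l₂ (m≤m+n l₂ K)) K≤l
                               lower upper l+2l₁≤2l₂ (l ^ 2) size
    where
    open ≤-Reasoning
    l₁≤l₂ : l₁ ≤ l₂
    l₁≤l₂ = ≮⇒≥ λ l₂<l₁ → <⇒≱ (+-mono-< l₂<l₁ l₂<l₁) (≤-trans (+-monoˡ-≤ l₁ (m≤n+m l₁ l)) l+2l₁≤2l₂)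
    size : suc (l₁ + l₂ + l) * suc (l + K) ≤ (2 * l + 1) * l ^ 2
    size = begin
      suc (l₁ + l₂ + l) * suc (l + K)   ≤⟨ *-mono-≤ (+-mono-≤ (+-mono-≤ l₁<l l₂≤l) (≤-refl {l}))
                                                      (s≤s (+-monoʳ-≤ l K≤l)) ⟩
      (l + l + l) * suc (l + l)          ≡⟨ collect l ⟩
      3 * l * (2 * l + 1)                ≤⟨ *-monoˡ-≤ (2 * l + 1) (*-monoˡ-≤ l 3≤l) ⟩
      l * l * (2 * l + 1)                ≡⟨ square l ⟩
      (2 * l + 1) * l ^ 2                ∎
      where
      collect : ∀ l → (l + l + l) * suc (l + l) ≡ 3 * l * (2 * l + 1)
      collect = solve-∀
      square : ∀ l → l * l * (2 * l + 1) ≡ (2 * l + 1) * (l * (l * 1))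
      square = solve-∀

module NarrowRange {l l₁ l₂ : ℕ} (h₁ : l < 100 * l₁) (h₂ : 10000 * l₁ < 101 * l)
                  (h₃ : 9901 * l < 10000 * l₂) (h₄ : 10000 * l₂ < 9999 * l) where
  open ≤-Reasoning

  0<l₁ : 0 < l₁
  0<l₁ = *-cancelˡ-< 100 0 l₁ (≤-<-trans z≤n h₁)

  l₁<l : l₁ < l
  l₁<l = *-cancelˡ-< 10000 l₁ l (<-≤-trans h₂ (*-monoˡ-≤ l (m≤m+n 101 9899)))

  l₂≤l : l₂ ≤ l
  l₂≤l = <⇒≤ (*-cancelˡ-< 10000 l₂ l (<-≤-trans h₄ (*-monoˡ-≤ l (m≤m+n 9999 1))))

  l≤l₁+l₂ : l ≤ l₁ + l₂
  l≤l₁+l₂ = <⇒≤ (*-cancelˡ-< 10000 l (l₁ + l₂) (begin-strict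
    10000 * l                            ≡⟨ split l ⟩
    100 * l + 9900 * l                   <⟨ +-mono-<-≤ (*-monoʳ-< 100 h₁) (*-monoˡ-≤ l (m≤m+n 9900 1)) ⟩
    100 * (100 * l₁) + 9901 * l          <⟨ +-monoʳ-< (100 * (100 * l₁)) h₃ ⟩
    100 * (100 * l₁) + 10000 * l₂        ≡⟨ merge l₁ l₂ ⟩
    10000 * (l₁ + l₂)                    ∎))
    where
    split : ∀ l → 10000 * l ≡ 100 * l + 9900 * l
    split = solve-∀
    merge : ∀ x y → 100 * (100 * x) + 10000 * y ≡ 10000 * (x + y)
    merge = solve-∀

  l+2l₁≤2l₂ : l + l₁ + l₁ ≤ l₂ + l₂
  l+2l₁≤2l₂ = <⇒≤ (*-cancelˡ-< 10000 (l + l₁ + l₁) (l₂ + l₂) (begin-strict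
    10000 * (l + l₁ + l₁)                ≡⟨ distrib l l₁ ⟩
    10000 * l + (10000 * l₁ + 10000 * l₁) <⟨ +-monoʳ-< (10000 * l) (+-mono-< h₂ h₂) ⟩
    10000 * l + (101 * l + 101 * l)      ≡⟨ collect l ⟩
    10202 * l                            ≤⟨ *-monoˡ-≤ l (m≤m+n 10202 9600) ⟩
    19802 * l                            ≡⟨ double l ⟩
    9901 * l + 9901 * l                  <⟨ +-mono-< h₃ h₃ ⟩
    10000 * l₂ + 10000 * l₂              ≡⟨ *-distribˡ-+ 10000 l₂ l₂ ⟨
    10000 * (l₂ + l₂)                    ∎))
    where
    distrib : ∀ l l₁ → 10000 * (l + l₁ + l₁) ≡ 10000 * l + (10000 * l₁ + 10000 * l₁)
    distrib = solve-∀
    collect : ∀ l → 10000 * l + (101 * l + 101 * l) ≡ 10202 * l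
    collect = solve-∀
    double : ∀ l → 19802 * l ≡ 9901 * l + 9901 * l
    double = solve-∀

claim5p3 : ∃₂ λ (c l₀ : ℕ) → 1 ≤ c ×
               ((l l₁ l₂ : ℕ) → l₀ ≤ l →
                 l < 100 * l₁ → 10000 * l₁ < 101 * l →
                 9901 * l < 10000 * l₂ → 10000 * l₂ < 9999 * l →
                 let k = floor (ℚ._*_ ((ℤ._-_ (+ (l * l + l₁ * l₁)) (+ (l₂ * l₂))) ℚ./ 1) (recipℕ (2 * l₁)))
                 in ℚ._≤_ 1ℚ (ℚ._*_ (CGsq l₁ (+ l₁) l₂ (ℤ._-_ k (+ l₁)) l k) (ℕ→ℚ (l ^ (2 * c)))))
claim5p3 = 1 , 3 , ≤-refl , λ l l₁ l₂ 3≤l h₁ h₂ h₃ h₄ →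
  let open NarrowRange {l} {l₁} {l₂} h₁ h₂ h₃ h₄
      open FloorChoice {l} {l₁} {l₂} 0<l₁ l₁<l l₂≤l l≤l₁+l₂ l+2l₁≤2l₂
  in subst (λ k → 1ℚ ℚ.≤ CGsq l₁ (+ l₁) l₂ (k ℤ.- + l₁) l k ℚ.* ℕ→ℚ (l ^ 2)) (sym floor≡K) (CGsq-at-floor-bound 3≤l)
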